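{- For all sufficiently large $n$, \[ \log\log(n-1)+1\ \le\ f_3(n,4)\ \le\ 2\log\log n . \]
   Context: Logarithms are base 2. $S_n$ is the set of permutations of $[n]$, viewed as linear orderings of $[n]$. For $P\in S_n$ and a 3-element $X\subseteq[n]$, $P_X\in S_3$ is the pattern (relative order) of $X$ in $P$. A family $\mathcal S\subseteq S_n$ partially shatters $X$ with $t$ orders if $|\{P_X:P\in\mathcal S\}|\ge t$, and $f_3(n,t)$ is the smallest size of a family in $S_n$ partially shattering every 3-element subset of $[n]$ with $t$ orders. -}

module Defs where

open import Data.Nat using (ℕ; _≤_; _<_; _^_; _*_; _∸_)
open import Data.Fin using (Fin) renaming (_<_ to _<ᶠ_)
open import Data.Fin.Properties using () renaming (_<?_ to _<ᶠ?_)
open import Data.Vec using (Vec; lookup)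
open import Data.List using (List; length)
open import Data.List.Relation.Unary.All using (All)
open import Data.List.Relation.Unary.Unique.Propositional using (Unique)
open import Data.List.Membership.Propositional using (_∈_)
open import Data.Bool using (Bool)
open import Data.Product using (Σ; _×_; _,_)
open import Relation.Binary.PropositionalEquality using (_≡_)
open import Relation.Nullary.Decidable using (⌊_⌋)

-- An element of S_n, viewed as a linear ordering of [n] = Fin n:
-- σ assigns to each element x its position (lookup σ x); x precedes y iff
-- lookup σ x < lookup σ y.  σ must be injective (hence a bijection).
IsPerm : ∀ {n} → Vec (Fin n) n → Set
IsPerm {n} σ = ∀ (i j : Fin n) → lookup σ i ≡ lookup σ j → i ≡ j

-- The pattern P_X ∈ S_3 of X = {a < b < c}: the relative order of a, b, c in σ,
-- recorded by the three pairwise comparisons (these determine and are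
-- determined by the element of S_3).
Pattern : Set
Pattern = Bool × Bool × Bool

pattern3 : ∀ {n} → Vec (Fin n) n → Fin n → Fin n → Fin n → Pattern
pattern3 σ a b c =
  ⌊ lookup σ a <ᶠ? lookup σ b ⌋ , ⌊ lookup σ a <ᶠ? lookup σ c ⌋ , ⌊ lookup σ b <ᶠ? lookup σ c ⌋

IsFamily : ∀ {n} → List (Vec (Fin n) n) → Set
IsFamily S = All IsPerm S × Unique S

ShattersTriple : ∀ {n} → List (Vec (Fin n) n) → ℕ → Fin n → Fin n → Fin n → Set
ShattersTriple S t a b c =
  Σ (List Pattern) λ L → Unique L × t ≤ length L ×
    All (λ p → Σ _ λ σ → σ ∈ S × pattern3 σ a b c ≡ p) L

PartiallyShatters : ∀ {n} → List (Vec (Fin n) n) → ℕ → Set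
PartiallyShatters {n} S t =
  ∀ (a b c : Fin n) → a <ᶠ b → b <ᶠ c → ShattersTriple S t a b c

IsF3 : ℕ → ℕ → ℕ → Set
IsF3 n t m =
  (Σ (List (Vec (Fin n) n)) λ S → IsFamily S × length S ≡ m × PartiallyShatters S t)
  × (∀ (S : List (Vec (Fin n) n)) → IsFamily S → PartiallyShatters S t → m ≤ length S)

-- log log (n-1) + 1 ≤ m   ⟺   (n-1)^2 ≤ 2^(2^m)     (for n - 1 ≥ 2)
LowerBound : ℕ → ℕ → Set
LowerBound n m = (n ∸ 1) ^ 2 ≤ 2 ^ (2 ^ m)

-- m ≤ 2 log log n   ⟺   log n ≥ 2^(m/2)
--   ⟺ every rational p/q ≥ 0 with p/q < 2^(m/2) (i.e. p² < 2^m q²) satisfies p/q ≤ log n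
--   (i.e. 2^p ≤ n^q).       (for n ≥ 2)
UpperBound : ℕ → ℕ → Set
UpperBound n m = ∀ (p q : ℕ) → 0 < q → p * p < 2 ^ m * (q * q) → 2 ^ p ≤ n ^ q

-- Sort [n] along one member σ of a family of m permutations and
-- apply Erdős–Szekeres once for each of the other m − 1 members: if
-- n > 2^(2^(m−1)) this leaves three elements that every member orders either
-- as σ does or in reverse, so they see only two patterns.  Hence
-- n ≤ 2^(2^(m−1)), i.e. log log n + 1 ≤ m.
--
-- For n ≤ 2^(3^t) encode the elements as binary words of
-- length 3^t and order them by value after xor-ing with a mask.  For three
-- distinct words, two of the three comparisons are decided by the mask bits at
-- two distinct positions (their first differences).  The two constant masks
-- and the 3t indicators "the i-th ternary digit of the position is d" take
-- all four value combinations on any two positions, so 2 + 3t permutations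
-- shatter every triple with 4 patterns; for t ≥ 30 this is at most
-- 2 log log n.

module Submission where

open import Data.Nat
  using (ℕ; zero; suc; _+_; _*_; _∸_; _^_; _≤_; _<_; z≤n; s≤s; _<?_; _≤?_; _≟_; _⊔_)
open import Data.Nat.Properties
open import Data.Nat.DivMod using (_%_; _/_; m≡m%n+[m/n]*n; m%n<n; m<n*o⇒m/o<n)
open import Data.Nat.Tactic.RingSolver using (solve-∀)
open import Data.Fin using (Fin; toℕ; fromℕ<) renaming (zero to fzero; suc to fsuc; _<_ to _<ᶠ_)
import Data.Fin.Properties as Fin
open import Data.Bool using (Bool; true; false; not; _xor_; if_then_else_)
import Data.Bool as Bool
open import Data.Bool.Properties using (not-injective; xor-comm; ¬-not)
open import Data.Vec using (Vec; []; _∷_; lookup; tabulate)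
open import Data.Vec.Properties using (lookup∘tabulate; ∷-injective; ≡-dec)
open import Data.List using (List; []; _∷_; length; allFin; map; deduplicate)
open import Data.List.Properties using (length-tabulate; length-map; length-deduplicate)
open import Data.List.Membership.Propositional using (_∈_)
open import Data.List.Membership.Propositional.Properties
  using (∈-allFin; ∈-map⁺; ∈-map⁻; ∈-deduplicate⁺; ∈-deduplicate⁻)
open import Data.List.Relation.Unary.Any using (here; there)
open import Data.List.Relation.Unary.All as All using (All; []; _∷_)
import Data.List.Relation.Unary.All.Properties as All
open import Data.List.Relation.Unary.AllPairs as AllPairs using (AllPairs; []; _∷_)
open import Data.List.Relation.Unary.Unique.Propositional using (Unique)
open import Data.List.Relation.Unary.Unique.Propositional.Properties using (allFin⁺; map⁺)
import Data.List.Relation.Unary.Unique.DecPropositional.Properties as Unique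
open import Data.List.Relation.Unary.Sorted.TotalOrder.Properties using (Sorted⇒AllPairs)
open import Data.List.Relation.Binary.Sublist.Propositional
  using (_⊆_; []; _∷_; _∷ʳ_; ⊆-refl; ⊆-trans)
open import Data.List.Relation.Binary.Sublist.Propositional.Properties using (All-resp-⊆)
open import Data.List.Relation.Binary.Permutation.Propositional using (_↭_; ↭-sym; ↭⇒↭ₛ)
open import Data.List.Relation.Binary.Permutation.Propositional.Properties using (↭-length; ∈-resp-↭)
import Data.List.Relation.Binary.Permutation.Setoid.Properties as Permutation
import Data.List.Sort as Sort
open import Data.Product using (Σ; ∃; _×_; _,_; proj₁; proj₂)
import Data.Product as Product
open import Data.Product.Properties using (×-≡,≡→≡)
open import Data.Sum using (_⊎_; inj₁; inj₂)
import Data.Sum as Sum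
open import Data.Unit using (⊤; tt)
open import Data.Empty using (⊥-elim)
open import Function using (_∘_; _∘′_; flip)
open import Function.Bundles using (mk⇔)
open import Function.Definitions using (Injective)
open import Relation.Binary.Bundles using (DecTotalOrder)
open import Relation.Binary.Definitions using (Asymmetric; DecidableEquality; tri<; tri≈; tri>)
import Relation.Binary.Construct.On as On
open import Relation.Binary.PropositionalEquality
open import Relation.Nullary using (Dec; yes; no; ¬_)
open import Relation.Nullary.Decidable using (⌊_⌋; isYes≗does; does-⇔; dec-true; dec-false)
open import Defs

keyPattern : ∀ {A : Set} → (A → ℕ) → A → A → A → Pattern
keyPattern κ a b c = ⌊ κ a <? κ b ⌋ , ⌊ κ a <? κ c ⌋ , ⌊ κ b <? κ c ⌋

reversedKeyPattern : ∀ {A : Set} → (A → ℕ) → A → A → A → Pattern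
reversedKeyPattern κ a b c = ⌊ κ b <? κ a ⌋ , ⌊ κ c <? κ a ⌋ , ⌊ κ c <? κ b ⌋

-- Fin's _<?_ compares toℕ, so pattern3 σ is definitionally keyPattern (position σ).
position : ∀ {n} → Vec (Fin n) n → Fin n → ℕ
position σ x = toℕ (lookup σ x)

position-injective : ∀ {n} (σ : Vec (Fin n) n) → IsPerm σ → Injective _≡_ _≡_ (position σ)
position-injective σ σ-perm = σ-perm _ _ ∘ Fin.toℕ-injective

⌊⌋-⇔ : ∀ {P Q : Set} → (P → Q) → (Q → P) → (p? : Dec P) (q? : Dec Q) →
       ⌊ p? ⌋ ≡ ⌊ q? ⌋
⌊⌋-⇔ f g p? q? = trans (isYes≗does p?) (trans (does-⇔ (mk⇔ f g) p? q?) (sym (isYes≗does q?)))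

⌊⌋-true : ∀ {P : Set} (p? : Dec P) → P → ⌊ p? ⌋ ≡ true
⌊⌋-true p? p = trans (isYes≗does p?) (dec-true p? p)

⌊⌋-false : ∀ {P : Set} (p? : Dec P) → ¬ P → ⌊ p? ⌋ ≡ false
⌊⌋-false p? ¬p = trans (isYes≗does p?) (dec-false p? ¬p)

-- Permutations from injective keys

module Count {A : Set} (κ : A → ℕ) where

  countBelow : ℕ → List A → ℕ
  countBelow t [] = 0
  countBelow t (y ∷ ys) with κ y <? t
  ... | yes _ = suc (countBelow t ys)
  ... | no _ = countBelow t ys

  countBelow-mono : ∀ {t t'} → t ≤ t' → ∀ ys → countBelow t ys ≤ countBelow t' ys
  countBelow-mono t≤t' [] = z≤n
  countBelow-mono {t} {t'} t≤t' (y ∷ ys) with κ y <? t | κ y <? t'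
  ... | yes _ | yes _ = s≤s (countBelow-mono t≤t' ys)
  ... | yes p | no q  = ⊥-elim (q (<-≤-trans p t≤t'))
  ... | no _  | yes _ = m≤n⇒m≤1+n (countBelow-mono t≤t' ys)
  ... | no _  | no _  = countBelow-mono t≤t' ys

  countBelow-mono-< : ∀ {t t' z} → t ≤ κ z → κ z < t' → ∀ {ys} → z ∈ ys →
                      countBelow t ys < countBelow t' ys
  countBelow-mono-< {t} {t'} t≤z z<t' {y ∷ ys} z∈ with κ y <? t | κ y <? t' | z∈
  ... | yes p | _     | here refl  = ⊥-elim (<⇒≱ p t≤z)
  ... | no _  | yes _ | here refl  = s≤s (countBelow-mono (≤-trans t≤z (<⇒≤ z<t')) ys)
  ... | no _  | no q  | here refl  = ⊥-elim (q z<t')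
  ... | yes _ | yes _ | there z∈ys = s≤s (countBelow-mono-< t≤z z<t' z∈ys)
  ... | yes p | no q  | there _    = ⊥-elim (q (<-≤-trans p (≤-trans t≤z (<⇒≤ z<t'))))
  ... | no _  | yes _ | there z∈ys = m≤n⇒m≤1+n (countBelow-mono-< t≤z z<t' z∈ys)
  ... | no _  | no _  | there z∈ys = countBelow-mono-< t≤z z<t' z∈ys

  countBelow≤length : ∀ t ys → countBelow t ys ≤ length ys
  countBelow≤length t [] = z≤n
  countBelow≤length t (y ∷ ys) with κ y <? t
  ... | yes _ = s≤s (countBelow≤length t ys)
  ... | no _ = m≤n⇒m≤1+n (countBelow≤length t ys)

module RankPermutation {n : ℕ} (κ : Fin n → ℕ) (κ-inj : Injective _≡_ _≡_ κ) where
  open Count κ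

  rank : Fin n → ℕ
  rank x = countBelow (κ x) (allFin n)

  rank-mono-< : ∀ {x y} → κ x < κ y → rank x < rank y
  rank-mono-< κx<κy = countBelow-mono-< ≤-refl κx<κy (∈-allFin _)

  rank-cancel-< : ∀ {x y} → rank x < rank y → κ x < κ y
  rank-cancel-< {x} {y} rx<ry with κ x <? κ y
  ... | yes κx<κy = κx<κy
  ... | no κx≮κy = ⊥-elim (<⇒≱ rx<ry (countBelow-mono (≮⇒≥ κx≮κy) (allFin n)))

  rank<n : ∀ x → rank x < n
  rank<n x = begin-strict
    rank x                            <⟨ countBelow-mono-< ≤-refl (n<1+n (κ x)) (∈-allFin x) ⟩
    countBelow (suc (κ x)) (allFin n) ≤⟨ countBelow≤length _ (allFin n) ⟩
    length (allFin n)                 ≡⟨ length-tabulate (λ i → i) ⟩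
    n                                 ∎
    where open ≤-Reasoning

  rankPerm : Vec (Fin n) n
  rankPerm = tabulate (λ x → fromℕ< (rank<n x))

  position-rankPerm : ∀ x → position rankPerm x ≡ rank x
  position-rankPerm x = trans (cong toℕ (lookup∘tabulate _ x)) (Fin.toℕ-fromℕ< (rank<n x))

  rankPerm-mono-< : ∀ {x y} → κ x < κ y → position rankPerm x < position rankPerm y
  rankPerm-mono-< {x} {y} =
    subst₂ _<_ (sym (position-rankPerm x)) (sym (position-rankPerm y)) ∘′ rank-mono-<

  rankPerm-cancel-< : ∀ {x y} → position rankPerm x < position rankPerm y → κ x < κ y
  rankPerm-cancel-< {x} {y} = rank-cancel-< ∘′ subst₂ _<_ (position-rankPerm x) (position-rankPerm y)

  rankPerm-isPerm : IsPerm rankPerm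
  rankPerm-isPerm i j σi≡σj with <-cmp (κ i) (κ j)
  ... | tri< κi<κj _ _ = ⊥-elim (<-irrefl (cong toℕ σi≡σj) (rankPerm-mono-< κi<κj))
  ... | tri≈ _ κi≡κj _ = κ-inj κi≡κj
  ... | tri> _ _ κj<κi = ⊥-elim (<-irrefl (cong toℕ (sym σi≡σj)) (rankPerm-mono-< κj<κi))

  pattern3-rankPerm : ∀ a b c → pattern3 rankPerm a b c ≡ keyPattern κ a b c
  pattern3-rankPerm a b c = cong₂ _,_ (same a b) (cong₂ _,_ (same a c) (same b c))
    where
    same : ∀ x y → ⌊ position rankPerm x <? position rankPerm y ⌋ ≡ ⌊ κ x <? κ y ⌋
    same x y = ⌊⌋-⇔ rankPerm-cancel-< rankPerm-mono-< _ _

-- Monotone sublists and the Erdős–Szekeres theorem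

AllPairs-resp-⊆ : ∀ {A : Set} {R : A → A → Set} {xs ys} →
                  xs ⊆ ys → AllPairs R ys → AllPairs R xs
AllPairs-resp-⊆ [] [] = []
AllPairs-resp-⊆ (_ ∷ʳ xs⊆ys) (_ ∷ pairs) = AllPairs-resp-⊆ xs⊆ys pairs
AllPairs-resp-⊆ (refl ∷ xs⊆ys) (px ∷ pairs) =
  All-resp-⊆ xs⊆ys px ∷ AllPairs-resp-⊆ xs⊆ys pairs

AllPairs-∈ : ∀ {A : Set} {R : A → A → Set} {xs u v} →
             AllPairs R xs → u ∈ xs → v ∈ xs → u ≢ v → R u v ⊎ R v u
AllPairs-∈ (_ ∷ _) (here refl) (here refl) u≢v = ⊥-elim (u≢v refl)
AllPairs-∈ (Ru ∷ _) (here refl) (there v∈xs) _ = inj₁ (All.lookup Ru v∈xs)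
AllPairs-∈ (Rv ∷ _) (there u∈xs) (here refl) _ = inj₂ (All.lookup Rv u∈xs)
AllPairs-∈ (_ ∷ pairs) (there u∈xs) (there v∈xs) u≢v = AllPairs-∈ pairs u∈xs v∈xs u≢v

module Monotone {A : Set} (κ : A → ℕ) where

  Increasing Decreasing Monotone : List A → Set
  Increasing = AllPairs (λ u v → κ u < κ v)
  Decreasing = AllPairs (λ u v → κ v < κ u)
  Monotone ys = Increasing ys ⊎ Decreasing ys

  Monotone-resp-⊆ : ∀ {xs ys} → xs ⊆ ys → Monotone ys → Monotone xs
  Monotone-resp-⊆ xs⊆ys = Sum.map (AllPairs-resp-⊆ xs⊆ys) (AllPairs-resp-⊆ xs⊆ys)

open Monotone using (Increasing; Decreasing; Monotone; Monotone-resp-⊆)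

module SortBy {A : Set} (κ : A → ℕ) where
  private
    byKey : DecTotalOrder _ _ _
    byKey = On.decTotalOrder ≤-decTotalOrder κ

  open Sort byKey public using () renaming (sort to sortBy; sort-↭ to sortBy-↭)

  length-sortBy : ∀ xs → length (sortBy xs) ≡ length xs
  length-sortBy xs = ↭-length (sortBy-↭ xs)

  sortBy-unique : ∀ {xs} → Unique xs → Unique (sortBy xs)
  sortBy-unique {xs} = Permutation.Unique-resp-↭ (setoid A) (↭⇒↭ₛ (↭-sym (sortBy-↭ xs)))

  sortBy-increasing : Injective _≡_ _≡_ κ → ∀ {xs} → Unique xs → Increasing κ (sortBy xs)
  sortBy-increasing κ-inj {xs} xs! = AllPairs.zipWith strict (sorted , sortBy-unique xs!)
    where
    sorted = Sorted⇒AllPairs (DecTotalOrder.totalOrder byKey) (Sort.sort-↗ byKey xs)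
    strict : ∀ {u v} → κ u ≤ κ v × u ≢ v → κ u < κ v
    strict (κu≤κv , u≢v) = ≤∧≢⇒< κu≤κv (u≢v ∘ κ-inj)

module ErdősSzekeres {A : Set} (κ : A → ℕ) where

  -- height x ys is the length of a longest increasing subsequence of ys whose
  -- keys all exceed κ x.
  height : A → List A → ℕ
  height x [] = 0
  height x (y ∷ ys) with κ x <? κ y
  ... | yes _ = suc (height y ys) ⊔ height x ys
  ... | no _ = height x ys

  height-∷ʳ : ∀ x z zs → height x zs ≤ height x (z ∷ zs)
  height-∷ʳ x z zs with κ x <? κ z
  ... | yes _ = m≤n⊔m (suc (height z zs)) (height x zs)
  ... | no _ = ≤-refl

  height-∷ : ∀ {x z} zs → κ x < κ z → suc (height z zs) ≤ height x (z ∷ zs)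
  height-∷ {x} {z} zs κx<κz with κ x <? κ z
  ... | yes _ = m≤m⊔n (suc (height z zs)) (height x zs)
  ... | no κx≮κz = ⊥-elim (κx≮κz κx<κz)

  increasingAbove : ∀ x ys → Σ (List A) λ zs → zs ⊆ ys × height x ys ≤ length zs ×
                    All (λ z → κ x < κ z) zs × Increasing κ zs
  increasingAbove x [] = [] , [] , z≤n , [] , []
  increasingAbove x (y ∷ ys) with κ x <? κ y
  ... | no _ with increasingAbove x ys
  ...   | zs , zs⊆ys , h≤ , above , inc = zs , y ∷ʳ zs⊆ys , h≤ , above , inc
  increasingAbove x (y ∷ ys) | yes κx<κy with ≤-total (height x ys) (suc (height y ys))
  ... | inj₁ hx≤hy with increasingAbove y ys
  ...   | zs , zs⊆ys , h≤ , above , inc =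
          y ∷ zs , refl ∷ zs⊆ys ,
          subst (_≤ suc (length zs)) (sym (m≥n⇒m⊔n≡m hx≤hy)) (s≤s h≤) ,
          κx<κy ∷ All.map (<-trans κx<κy) above , above ∷ inc
  increasingAbove x (y ∷ ys) | yes _ | inj₂ hy≤hx with increasingAbove x ys
  ...   | zs , zs⊆ys , h≤ , above , inc =
          zs , y ∷ʳ zs⊆ys , subst (_≤ length zs) (sym (m≤n⇒m⊔n≡n hy≤hx)) h≤ , above , inc

  layer : ℕ → List A → List A
  layer ℓ [] = []
  layer ℓ (x ∷ xs) with height x xs ≟ ℓ
  ... | yes _ = x ∷ layer ℓ xs
  ... | no _ = layer ℓ xs

  layer-⊆ : ∀ ℓ xs → layer ℓ xs ⊆ xs
  layer-⊆ ℓ [] = []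
  layer-⊆ ℓ (x ∷ xs) with height x xs ≟ ℓ
  ... | yes _ = refl ∷ layer-⊆ ℓ xs
  ... | no _ = x ∷ʳ layer-⊆ ℓ xs

  layer-below : ∀ {x ℓ} xs → height x xs ≤ ℓ → All (λ y → κ x ≢ κ y) xs →
                All (λ y → κ y < κ x) (layer ℓ xs)
  layer-below [] _ [] = []
  layer-below {x} {ℓ} (z ∷ zs) hx≤ℓ (κx≢κz ∷ distinct)
    with height z zs ≟ ℓ | layer-below zs (≤-trans (height-∷ʳ x z zs) hx≤ℓ) distinct
  ... | no _ | below = below
  ... | yes hz≡ℓ | below with <-cmp (κ z) (κ x)
  ...   | tri< κz<κx _ _ = κz<κx ∷ below
  ...   | tri≈ _ κz≡κx _ = ⊥-elim (κx≢κz (sym κz≡κx))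
  ...   | tri> _ _ κx<κz =
    ⊥-elim (<⇒≱ (subst (λ h → suc h ≤ height x (z ∷ zs)) hz≡ℓ (height-∷ zs κx<κz)) hx≤ℓ)

  layer-decreasing : ∀ ℓ xs → AllPairs (λ u v → κ u ≢ κ v) xs → Decreasing κ (layer ℓ xs)
  layer-decreasing ℓ [] [] = []
  layer-decreasing ℓ (x ∷ xs) (distinct ∷ pairs) with height x xs ≟ ℓ
  ... | yes hx≡ℓ = layer-below xs (≤-reflexive hx≡ℓ) distinct ∷ layer-decreasing ℓ xs pairs
  ... | no _ = layer-decreasing ℓ xs pairs

  HeightsBelow : ℕ → List A → Set
  HeightsBelow r [] = ⊤
  HeightsBelow r (x ∷ xs) = height x xs < r × HeightsBelow r xs

  longIncreasing⊎heightsBelow : ∀ r xs →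
    (Σ (List A) λ ys → ys ⊆ xs × r < length ys × Increasing κ ys) ⊎ HeightsBelow r xs
  longIncreasing⊎heightsBelow r [] = inj₂ tt
  longIncreasing⊎heightsBelow r (x ∷ xs) with r ≤? height x xs
  ... | yes r≤hx with increasingAbove x xs
  ...   | ys , ys⊆xs , hx≤ , above , inc =
    inj₁ (x ∷ ys , refl ∷ ys⊆xs , s≤s (≤-trans r≤hx hx≤) , above ∷ inc)
  longIncreasing⊎heightsBelow r (x ∷ xs) | no r≰hx with longIncreasing⊎heightsBelow r xs
  ... | inj₁ (ys , ys⊆xs , long , inc) = inj₁ (ys , x ∷ʳ ys⊆xs , long , inc)
  ... | inj₂ below = inj₂ (≰⇒> r≰hx , below)

  layersSize : ℕ → List A → ℕ
  layersSize zero xs = 0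
  layersSize (suc r) xs = layersSize r xs + length (layer r xs)

  layersSize-∷-high : ∀ {r x} xs → r ≤ height x xs → layersSize r (x ∷ xs) ≡ layersSize r xs
  layersSize-∷-high {zero} xs _ = refl
  layersSize-∷-high {suc r} {x} xs r<hx with height x xs ≟ r
  ... | yes hx≡r = ⊥-elim (<-irrefl (sym hx≡r) r<hx)
  ... | no _ = cong (_+ length (layer r xs)) (layersSize-∷-high xs (<⇒≤ r<hx))

  layersSize-∷-low : ∀ {r x} xs → height x xs < r → layersSize r (x ∷ xs) ≡ suc (layersSize r xs)
  layersSize-∷-low {suc r} {x} xs hx<1+r with height x xs ≟ r
  ... | yes hx≡r = begin
    layersSize r (x ∷ xs) + suc (length (layer r xs))
      ≡⟨ cong (_+ _) (layersSize-∷-high xs (≤-reflexive (sym hx≡r))) ⟩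
    layersSize r xs + suc (length (layer r xs))
      ≡⟨ +-suc (layersSize r xs) _ ⟩
    suc (layersSize r xs + length (layer r xs))
      ∎
    where open ≡-Reasoning
  ... | no hx≢r = cong (_+ length (layer r xs)) (layersSize-∷-low xs (≤∧≢⇒< (≤-pred hx<1+r) hx≢r))

  length≤layersSize : ∀ r xs → HeightsBelow r xs → length xs ≤ layersSize r xs
  length≤layersSize r [] _ = z≤n
  length≤layersSize r (x ∷ xs) (hx<r , below) =
    subst (suc (length xs) ≤_) (sym (layersSize-∷-low xs hx<r)) (s≤s (length≤layersSize r xs below))

  layersSize≤⊎longLayer : ∀ r s xs →
    layersSize r xs ≤ r * s ⊎ ∃ λ ℓ → s < length (layer ℓ xs)
  layersSize≤⊎longLayer zero s xs = inj₁ z≤n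
  layersSize≤⊎longLayer (suc r) s xs with layersSize≤⊎longLayer r s xs | s <? length (layer r xs)
  ... | inj₂ long | _ = inj₂ long
  ... | inj₁ _ | yes long = inj₂ (r , long)
  ... | inj₁ size≤ | no short =
    inj₁ (subst (layersSize r xs + length (layer r xs) ≤_) (+-comm (r * s) s)
                (+-mono-≤ size≤ (≮⇒≥ short)))

  erdős–szekeres : ∀ r s xs → AllPairs (λ u v → κ u ≢ κ v) xs → r * s < length xs →
    Σ (List A) λ ys → ys ⊆ xs ×
      ((r < length ys × Increasing κ ys) ⊎ (s < length ys × Decreasing κ ys))
  erdős–szekeres r s xs distinct rs<len with longIncreasing⊎heightsBelow r xs
  ... | inj₁ (ys , ys⊆xs , long , inc) = ys , ys⊆xs , inj₁ (long , inc)
  ... | inj₂ below with layersSize≤⊎longLayer r s xs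
  ...   | inj₁ size≤ = ⊥-elim (<⇒≱ rs<len (≤-trans (length≤layersSize r xs below) size≤))
  ...   | inj₂ (ℓ , long) = layer ℓ xs , layer-⊆ ℓ xs , inj₂ (long , layer-decreasing ℓ xs distinct)

open ErdősSzekeres using (erdős–szekeres)

-- Each key costs one square root: Erdős–Szekeres with r = s = √(length xs).
monotoneForAll : ∀ {A : Set} (N : ℕ) (κs : List (A → ℕ)) → All (Injective _≡_ _≡_) κs →
  ∀ xs → Unique xs → N ^ (2 ^ length κs) < length xs →
  Σ (List A) λ ys → ys ⊆ xs × N < length ys × All (λ κ → Monotone κ ys) κs
monotoneForAll N [] [] xs _ N<len = xs , ⊆-refl , subst (_< length xs) (^-identityʳ N) N<len , []
monotoneForAll N (κ ∷ κs) (κ-inj ∷ injs) xs xs! big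
  with erdős–szekeres κ (N ^ (2 ^ length κs)) (N ^ (2 ^ length κs)) xs
         (AllPairs.map (λ x≢y → x≢y ∘ κ-inj) xs!) (subst (_< length xs) square big)
  where
  square : N ^ (2 ^ suc (length κs)) ≡ N ^ (2 ^ length κs) * N ^ (2 ^ length κs)
  square = trans (cong (λ e → N ^ (2 ^ length κs + e)) (+-identityʳ _))
                 (^-distribˡ-+-* N (2 ^ length κs) (2 ^ length κs))
... | ys , ys⊆xs , result
  with monotoneForAll N κs injs ys (AllPairs-resp-⊆ ys⊆xs xs!) (Sum.[ proj₁ , proj₁ ]′ result)
...   | zs , zs⊆ys , long , monotone =
        zs , ⊆-trans zs⊆ys ys⊆xs , long ,
        Monotone-resp-⊆ κ zs⊆ys (Sum.map proj₂ proj₂ result) ∷ monotone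

increasingTriple : ∀ {A : Set} (κ : A → ℕ) → Injective _≡_ _≡_ κ →
  ∀ ys → Unique ys → 2 < length ys →
  Σ A λ a → Σ A λ b → Σ A λ c → κ a < κ b × κ b < κ c × a ∈ ys × b ∈ ys × c ∈ ys
increasingTriple {A} κ κ-inj ys ys! long =
  firstThree (sortBy ys) (sortBy-↭ ys) (sortBy-increasing κ-inj ys!)
             (subst (2 <_) (sym (length-sortBy ys)) long)
  where
  open SortBy κ
  firstThree : ∀ zs → zs ↭ ys → Increasing κ zs → 2 < length zs →
    Σ A λ a → Σ A λ b → Σ A λ c → κ a < κ b × κ b < κ c × a ∈ ys × b ∈ ys × c ∈ ys
  firstThree (a ∷ b ∷ c ∷ _) zs↭ys ((a<b ∷ _) ∷ (b<c ∷ _) ∷ _) _ =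
    a , b , c , a<b , b<c , ∈-resp-↭ zs↭ys (here refl) , ∈-resp-↭ zs↭ys (there (here refl)) ,
    ∈-resp-↭ zs↭ys (there (there (here refl)))
  firstThree [] _ _ ()
  firstThree (_ ∷ []) _ _ (s≤s ())
  firstThree (_ ∷ _ ∷ []) _ _ (s≤s (s≤s ()))

-- The lower bound

module _ {A : Set} {κ τ : A → ℕ} {ys : List A} where

  private
    transfer : ∀ {P R : A → A → Set} → Asymmetric P → AllPairs (λ u v → P u v × R u v) ys →
               ∀ {u v} → u ∈ ys → v ∈ ys → P u v → R u v
    transfer asym pairs u∈ys v∈ys Puv with AllPairs-∈ pairs u∈ys v∈ys (λ { refl → asym Puv Puv })
    ... | inj₁ (_ , Ruv) = Ruv
    ... | inj₂ (Pvu , _) = ⊥-elim (asym Puv Pvu)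

    swapPairs : ∀ {P R : A → A → Set} → AllPairs (λ u v → P u v × R u v) ys →
                AllPairs (λ u v → R u v × P u v) ys
    swapPairs = AllPairs.map Product.swap

  keyPattern-alike : Increasing κ ys → Increasing τ ys →
    ∀ {a b c} → a ∈ ys → b ∈ ys → c ∈ ys →
    keyPattern τ a b c ≡ keyPattern κ a b c
  keyPattern-alike κ↑ τ↑ a∈ b∈ c∈ =
    cong₂ _,_ (alike a∈ b∈) (cong₂ _,_ (alike a∈ c∈) (alike b∈ c∈))
    where
    both = AllPairs.zip (κ↑ , τ↑)
    alike : ∀ {u v} → u ∈ ys → v ∈ ys → ⌊ τ u <? τ v ⌋ ≡ ⌊ κ u <? κ v ⌋
    alike u∈ v∈ =
      ⌊⌋-⇔ (transfer <-asym (swapPairs both) u∈ v∈) (transfer <-asym both u∈ v∈) _ _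

  keyPattern-opposite : Increasing κ ys → Decreasing τ ys →
    ∀ {a b c} → a ∈ ys → b ∈ ys → c ∈ ys →
    keyPattern τ a b c ≡ reversedKeyPattern κ a b c
  keyPattern-opposite κ↑ τ↓ a∈ b∈ c∈ =
    cong₂ _,_ (opposite a∈ b∈) (cong₂ _,_ (opposite a∈ c∈) (opposite b∈ c∈))
    where
    both = AllPairs.zip (κ↑ , τ↓)
    opposite : ∀ {u v} → u ∈ ys → v ∈ ys → ⌊ τ u <? τ v ⌋ ≡ ⌊ κ v <? κ u ⌋
    opposite u∈ v∈ =
      ⌊⌋-⇔ (transfer (flip <-asym) (swapPairs both) v∈ u∈) (transfer <-asym both v∈ u∈) _ _

  keyPattern-monotone : Increasing κ ys → Monotone τ ys →
    ∀ {a b c} → a ∈ ys → b ∈ ys → c ∈ ys →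
    keyPattern τ a b c ≡ keyPattern κ a b c ⊎ keyPattern τ a b c ≡ reversedKeyPattern κ a b c
  keyPattern-monotone κ↑ (inj₁ τ↑) a∈ b∈ c∈ = inj₁ (keyPattern-alike κ↑ τ↑ a∈ b∈ c∈)
  keyPattern-monotone κ↑ (inj₂ τ↓) a∈ b∈ c∈ = inj₂ (keyPattern-opposite κ↑ τ↓ a∈ b∈ c∈)

unique-⊆-pair⇒length≤2 : ∀ {A : Set} {P Q : A} (L : List A) → Unique L →
                          All (λ p → p ≡ P ⊎ p ≡ Q) L → length L ≤ 2
unique-⊆-pair⇒length≤2 [] _ _ = z≤n
unique-⊆-pair⇒length≤2 (_ ∷ []) _ _ = s≤s z≤n
unique-⊆-pair⇒length≤2 (_ ∷ _ ∷ []) _ _ = s≤s (s≤s z≤n)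
unique-⊆-pair⇒length≤2 (_ ∷ _ ∷ _ ∷ _) ((x≢y ∷ x≢z ∷ _) ∷ (y≢z ∷ _) ∷ _)
                       (x∈ ∷ y∈ ∷ z∈ ∷ _) with x∈ | y∈ | z∈
... | inj₁ refl | inj₁ refl | _         = ⊥-elim (x≢y refl)
... | inj₂ refl | inj₂ refl | _         = ⊥-elim (x≢y refl)
... | inj₁ refl | inj₂ refl | inj₁ refl = ⊥-elim (x≢z refl)
... | inj₁ refl | inj₂ refl | inj₂ refl = ⊥-elim (y≢z refl)
... | inj₂ refl | inj₁ refl | inj₁ refl = ⊥-elim (y≢z refl)
... | inj₂ refl | inj₁ refl | inj₂ refl = ⊥-elim (x≢z refl)

module _ {n : ℕ} where

  monotone⇒shattersTriple≤2 : ∀ {σ : Vec (Fin n) n} {S ys a b c t} →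
    Increasing (position σ) ys → All (λ τ → Monotone (position τ) ys) S →
    a ∈ ys → b ∈ ys → c ∈ ys → ShattersTriple S t a b c → t ≤ 2
  monotone⇒shattersTriple≤2 {σ} {S} {ys} {a} {b} {c} σ↑ monotone a∈ b∈ c∈
                            (L , L! , t≤|L| , realised) =
    ≤-trans t≤|L| (unique-⊆-pair⇒length≤2 L L! (All.map oneOfTwo realised))
    where
    oneOfTwo : ∀ {p} → Σ _ (λ τ → τ ∈ S × pattern3 τ a b c ≡ p) →
               p ≡ keyPattern (position σ) a b c ⊎ p ≡ reversedKeyPattern (position σ) a b c
    oneOfTwo (τ , τ∈S , refl) = keyPattern-monotone σ↑ (All.lookup monotone τ∈S) a∈ b∈ c∈

  -- Sorting [n] along σ makes σ increasing for free, so only the other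
  -- members of the family cost a square root each.
  shattering⇒≤2^2^ : ∀ σ rest → All IsPerm (σ ∷ rest) → PartiallyShatters (σ ∷ rest) 4 →
                     n ≤ 2 ^ (2 ^ length rest)
  shattering⇒≤2^2^ σ rest (σ-perm ∷ perms) shatters = ≮⇒≥ tooLong
    where
    open SortBy (position σ)
    xs = sortBy (allFin n)
    xs↑ : Increasing (position σ) xs
    xs↑ = sortBy-increasing (position-injective σ σ-perm) (allFin⁺ n)
    xs! : Unique xs
    xs! = sortBy-unique (allFin⁺ n)
    |xs|≡n : length xs ≡ n
    |xs|≡n = trans (length-sortBy (allFin n)) (length-tabulate (λ i → i))
    keys-injective : All (Injective _≡_ _≡_) (map position rest)
    keys-injective = All.map⁺ (All.map (λ {τ} → position-injective τ) perms)
    4≰2 : ¬ 4 ≤ 2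
    4≰2 (s≤s (s≤s ()))
    tooLong : ¬ 2 ^ (2 ^ length rest) < n
    tooLong big with monotoneForAll 2 (map position rest) keys-injective xs xs!
                       (subst₂ (λ r l → 2 ^ (2 ^ r) < l) (sym (length-map position rest)) (sym |xs|≡n) big)
    ... | ys , ys⊆xs , long , monotone
      with increasingTriple toℕ Fin.toℕ-injective ys (AllPairs-resp-⊆ ys⊆xs xs!) long
    ...   | a , b , c , a<b , b<c , a∈ys , b∈ys , c∈ys =
      4≰2 (monotone⇒shattersTriple≤2 {σ = σ} ys↑ (inj₁ ys↑ ∷ All.map⁻ monotone) a∈ys b∈ys c∈ys
                                      (shatters a b c a<b b<c))
      where
      ys↑ : Increasing (position σ) ys
      ys↑ = AllPairs-resp-⊆ ys⊆xs xs↑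

¬shatters-[] : ∀ {n} → 3 ≤ n → ¬ PartiallyShatters {n} [] 4
¬shatters-[] {suc (suc zero)} (s≤s (s≤s ()))
¬shatters-[] {suc (suc (suc _))} _ shatters
  with shatters fzero (fsuc fzero) (fsuc (fsuc fzero)) (s≤s z≤n) (s≤s (s≤s z≤n))
... | _ ∷ _ , _ , _ , (_ , () , _) ∷ _

lowerBound : ∀ {n m} → 3 ≤ n → IsF3 n 4 m → LowerBound n m
lowerBound 3≤n (([] , _ , _ , shatters) , _) = ⊥-elim (¬shatters-[] 3≤n shatters)
lowerBound {n} _ ((σ ∷ rest , (perms , _) , refl , shatters) , _) = begin
  (n ∸ 1) ^ 2                      ≤⟨ ^-monoˡ-≤ 2 (m∸n≤m n 1) ⟩
  n ^ 2                            ≤⟨ ^-monoˡ-≤ 2 (shattering⇒≤2^2^ σ rest perms shatters) ⟩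
  (2 ^ (2 ^ length rest)) ^ 2      ≡⟨ ^-*-assoc 2 (2 ^ length rest) 2 ⟩
  2 ^ (2 ^ length rest * 2)        ≡⟨ cong (2 ^_) (*-comm (2 ^ length rest) 2) ⟩
  2 ^ (2 ^ suc (length rest))      ∎
  where open ≤-Reasoning

-- Masked binary words

value : ∀ {k} → Vec Bool k → ℕ
value [] = 0
value {suc k} (b ∷ w) = (if b then 2 ^ k else 0) + value w

value<2^ : ∀ {k} (w : Vec Bool k) → value w < 2 ^ k
value<2^ [] = s≤s z≤n
value<2^ {suc k} (false ∷ w) = <-≤-trans (value<2^ w) (m≤m+n (2 ^ k) (2 ^ k + 0))
value<2^ {suc k} (true ∷ w) = +-monoʳ-< (2 ^ k) (<-≤-trans (value<2^ w) (m≤m+n (2 ^ k) 0))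

value-false<value-true : ∀ {k} (u v : Vec Bool k) → value (false ∷ u) < value (true ∷ v)
value-false<value-true {k} u v = <-≤-trans (value<2^ u) (m≤m+n (2 ^ k) (value v))

value-injective : ∀ {k} {u v : Vec Bool k} → value u ≡ value v → u ≡ v
value-injective {u = []} {[]} _ = refl
value-injective {u = false ∷ u} {false ∷ v} eq = cong (false ∷_) (value-injective eq)
value-injective {u = true ∷ u} {true ∷ v} eq =
  cong (true ∷_) (value-injective (+-cancelˡ-≡ _ _ _ eq))
value-injective {u = false ∷ u} {true ∷ v} eq = ⊥-elim (<-irrefl eq (value-false<value-true u v))
value-injective {u = true ∷ u} {false ∷ v} eq =
  ⊥-elim (<-irrefl (sym eq) (value-false<value-true v u))

toBits : (k : ℕ) → ℕ → Vec Bool k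
toBits zero x = []
toBits (suc k) x with 2 ^ k ≤? x
... | yes _ = true ∷ toBits k (x ∸ 2 ^ k)
... | no _ = false ∷ toBits k x

value-toBits : ∀ k {x} → x < 2 ^ k → value (toBits k x) ≡ x
value-toBits zero {zero} _ = refl
value-toBits zero {suc _} (s≤s ())
value-toBits (suc k) {x} x<2^1+k with 2 ^ k ≤? x
... | no 2^k≰x = value-toBits k (≰⇒> 2^k≰x)
... | yes 2^k≤x = begin
  2 ^ k + value (toBits k (x ∸ 2 ^ k)) ≡⟨ cong (2 ^ k +_) (value-toBits k x∸2^k<2^k) ⟩
  2 ^ k + (x ∸ 2 ^ k)                 ≡⟨ m+[n∸m]≡n 2^k≤x ⟩
  x                                    ∎
  where
  open ≡-Reasoning
  x∸2^k<2^k : x ∸ 2 ^ k < 2 ^ k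
  x∸2^k<2^k = +-cancelˡ-< (2 ^ k) _ _
    (subst₂ _<_ (sym (m+[n∸m]≡n 2^k≤x)) (cong (2 ^ k +_) (+-identityʳ _)) x<2^1+k)

Mask : ℕ → Set
Mask k = Fin k → Bool

_⊕_ : ∀ {k} → Vec Bool k → Mask k → Vec Bool k
[] ⊕ m = []
(b ∷ w) ⊕ m = (b xor m fzero) ∷ (w ⊕ (m ∘ fsuc))

xor-cancelˡ : ∀ x {a b} → x xor a ≡ x xor b → a ≡ b
xor-cancelˡ false eq = eq
xor-cancelˡ true eq = not-injective eq

xor-cancelʳ : ∀ x {a b} → a xor x ≡ b xor x → a ≡ b
xor-cancelʳ x {a} {b} eq = xor-cancelˡ x (trans (xor-comm x a) (trans eq (xor-comm b x)))

⊕-cancelʳ : ∀ {k} (m : Mask k) {u v : Vec Bool k} → u ⊕ m ≡ v ⊕ m → u ≡ v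
⊕-cancelʳ m {[]} {[]} _ = refl
⊕-cancelʳ m {a ∷ u} {b ∷ v} eq with ∷-injective eq
... | head≡ , tail≡ = cong₂ _∷_ (xor-cancelʳ (m fzero) head≡) (⊕-cancelʳ (m ∘ fsuc) tail≡)

maskedValue : ∀ {k} → Mask k → Vec Bool k → ℕ
maskedValue m w = value (w ⊕ m)

maskedLess : ∀ {k} → Mask k → Vec Bool k → Vec Bool k → Bool
maskedLess m u v = ⌊ maskedValue m u <? maskedValue m v ⌋

maskedPattern : ∀ {k} → Mask k → Vec Bool k → Vec Bool k → Vec Bool k → Pattern
maskedPattern m = keyPattern (maskedValue m)

maskedLess-∷-same : ∀ {k} b (u v : Vec Bool k) (m : Mask (suc k)) →
                    maskedLess m (b ∷ u) (b ∷ v) ≡ maskedLess (m ∘ fsuc) u v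
maskedLess-∷-same b u v m = ⌊⌋-⇔ (+-cancelˡ-< _ _ _) (+-monoʳ-< _) _ _

less-false-true : ∀ {k} (u v : Vec Bool k) → ⌊ value (false ∷ u) <? value (true ∷ v) ⌋ ≡ true
less-false-true u v with value (false ∷ u) <? value (true ∷ v)
... | yes _ = refl
... | no ≮ = ⊥-elim (≮ (value-false<value-true u v))

less-true-false : ∀ {k} (u v : Vec Bool k) → ⌊ value (true ∷ u) <? value (false ∷ v) ⌋ ≡ false
less-true-false u v with value (true ∷ u) <? value (false ∷ v)
... | yes lt = ⊥-elim (<-asym lt (value-false<value-true v u))
... | no _ = refl

maskedLess-∷-differ : ∀ {k} b (u v : Vec Bool k) (m : Mask (suc k)) →
                      maskedLess m (b ∷ u) (not b ∷ v) ≡ not (b xor m fzero)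
maskedLess-∷-differ b u v m with b | m fzero
... | false | false = less-false-true (u ⊕ (m ∘ fsuc)) (v ⊕ (m ∘ fsuc))
... | true  | true  = less-false-true (u ⊕ (m ∘ fsuc)) (v ⊕ (m ∘ fsuc))
... | false | true  = less-true-false (u ⊕ (m ∘ fsuc)) (v ⊕ (m ∘ fsuc))
... | true  | false = less-true-false (u ⊕ (m ∘ fsuc)) (v ⊕ (m ∘ fsuc))

Determines : ∀ {k} {X : Set} → (Mask k → X) → Fin k → Set
Determines f i = ∀ m m' → f m ≡ f m' → m i ≡ m' i

determines-∘ : ∀ {k} {X Y : Set} {f : Mask k → X} {i} (h : X → Y) →
               Determines (h ∘ f) i → Determines f i
determines-∘ h det m m' fm≡fm' = det m m' (cong h fm≡fm')

headDetermines : ∀ {k} b (u v : Vec Bool k) →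
                 Determines (λ m → maskedLess m (b ∷ u) (not b ∷ v)) fzero
headDetermines b u v m m' eq = xor-cancelˡ b (not-injective (begin
  not (b xor m fzero)                ≡⟨ sym (maskedLess-∷-differ b u v m) ⟩
  maskedLess m (b ∷ u) (not b ∷ v)   ≡⟨ eq ⟩
  maskedLess m' (b ∷ u) (not b ∷ v)  ≡⟨ maskedLess-∷-differ b u v m' ⟩
  not (b xor m' fzero)               ∎))
  where open ≡-Reasoning

tailDetermines : ∀ {k} b (u v : Vec Bool k) {j} → Determines (λ m → maskedLess m u v) j →
                 Determines (λ m → maskedLess m (b ∷ u) (b ∷ v)) (fsuc j)
tailDetermines b u v det m m' eq =
  det (m ∘ fsuc) (m' ∘ fsuc)
    (trans (sym (maskedLess-∷-same b u v m)) (trans eq (maskedLess-∷-same b u v m')))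

-- The comparison of two distinct words under all masks is governed by the
-- bit of the mask at their first difference.
tail-≢ : ∀ {k} {x : Bool} {u v : Vec Bool k} → x ∷ u ≢ x ∷ v → u ≢ v
tail-≢ x∷u≢x∷v = x∷u≢x∷v ∘ cong (_ ∷_)

firstDifference : ∀ {k} (u v : Vec Bool k) → u ≢ v → ∃ (Determines (λ m → maskedLess m u v))
firstDifference [] [] u≢v = ⊥-elim (u≢v refl)
firstDifference (a ∷ u) (b ∷ v) u≢v with a Bool.≟ b
... | yes refl = Product.map fsuc (tailDetermines a u v) (firstDifference u v (tail-≢ u≢v))
... | no a≢b rewrite ¬-not (a≢b ∘ sym) = fzero , headDetermines a u v

TwoDeterminedBits : ∀ {k} → (Mask k → Pattern) → Set
TwoDeterminedBits {k} f = Σ (Fin k) λ i → Σ (Fin k) λ j → i ≢ j × Determines f i × Determines f j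

maskedPattern-∷ : ∀ {k} x (a b c : Vec Bool k) (m : Mask (suc k)) →
                  maskedPattern m (x ∷ a) (x ∷ b) (x ∷ c) ≡ maskedPattern (m ∘ fsuc) a b c
maskedPattern-∷ x a b c m =
  cong₂ _,_ (maskedLess-∷-same x a b m)
            (cong₂ _,_ (maskedLess-∷-same x a c m) (maskedLess-∷-same x b c m))

private
  oddFirst : ∀ {k} x (a b c : Vec Bool k) → b ≢ c →
             TwoDeterminedBits (λ m → maskedPattern m (x ∷ a) (not x ∷ b) (not x ∷ c))
  oddFirst x a b c b≢c with firstDifference b c b≢c
  ... | j , det = fzero , fsuc j , (λ ()) , determines-∘ proj₁ (headDetermines x a b) ,
                  determines-∘ (proj₂ ∘ proj₂) (tailDetermines (not x) b c det)

  oddSecond : ∀ {k} x (a b c : Vec Bool k) → a ≢ c →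
              TwoDeterminedBits (λ m → maskedPattern m (x ∷ a) (not x ∷ b) (x ∷ c))
  oddSecond x a b c a≢c with firstDifference a c a≢c
  ... | j , det = fzero , fsuc j , (λ ()) , determines-∘ proj₁ (headDetermines x a b) ,
                  determines-∘ (proj₁ ∘ proj₂) (tailDetermines x a c det)

  oddThird : ∀ {k} x (a b c : Vec Bool k) → a ≢ b →
             TwoDeterminedBits (λ m → maskedPattern m (x ∷ a) (x ∷ b) (not x ∷ c))
  oddThird x a b c a≢b with firstDifference a b a≢b
  ... | j , det = fzero , fsuc j , (λ ()) , determines-∘ (proj₁ ∘ proj₂) (headDetermines x a c) ,
                  determines-∘ proj₁ (tailDetermines x a b det)

  sharedHead : ∀ {k} x (a b c : Vec Bool k) → TwoDeterminedBits (λ m → maskedPattern m a b c) →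
               TwoDeterminedBits (λ m → maskedPattern m (x ∷ a) (x ∷ b) (x ∷ c))
  sharedHead x a b c (i , j , i≢j , detᵢ , detⱼ) =
    fsuc i , fsuc j , i≢j ∘ Fin.suc-injective , shift detᵢ , shift detⱼ
    where
    shift : ∀ {l} → Determines (λ m → maskedPattern m a b c) l →
            Determines (λ m → maskedPattern m (x ∷ a) (x ∷ b) (x ∷ c)) (fsuc l)
    shift det m m' eq = det (m ∘ fsuc) (m' ∘ fsuc)
      (trans (sym (maskedPattern-∷ x a b c m)) (trans eq (maskedPattern-∷ x a b c m')))

-- Among three distinct words, two of the three pairwise first differences
-- occur at distinct positions.
twoDeterminedBits : ∀ {k} (a b c : Vec Bool k) → a ≢ b → a ≢ c → b ≢ c →
                    TwoDeterminedBits (λ m → maskedPattern m a b c)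
twoDeterminedBits [] [] [] a≢b _ _ = ⊥-elim (a≢b refl)
twoDeterminedBits (true ∷ a) (false ∷ b) (false ∷ c) _ _ b≢c = oddFirst true a b c (tail-≢ b≢c)
twoDeterminedBits (false ∷ a) (true ∷ b) (true ∷ c) _ _ b≢c = oddFirst false a b c (tail-≢ b≢c)
twoDeterminedBits (true ∷ a) (false ∷ b) (true ∷ c) _ a≢c _ = oddSecond true a b c (tail-≢ a≢c)
twoDeterminedBits (false ∷ a) (true ∷ b) (false ∷ c) _ a≢c _ = oddSecond false a b c (tail-≢ a≢c)
twoDeterminedBits (true ∷ a) (true ∷ b) (false ∷ c) a≢b _ _ = oddThird true a b c (tail-≢ a≢b)
twoDeterminedBits (false ∷ a) (false ∷ b) (true ∷ c) a≢b _ _ = oddThird false a b c (tail-≢ a≢b)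
twoDeterminedBits (true ∷ a) (true ∷ b) (true ∷ c) a≢b a≢c b≢c =
  sharedHead true a b c (twoDeterminedBits a b c (tail-≢ a≢b) (tail-≢ a≢c) (tail-≢ b≢c))
twoDeterminedBits (false ∷ a) (false ∷ b) (false ∷ c) a≢b a≢c b≢c =
  sharedHead false a b c (twoDeterminedBits a b c (tail-≢ a≢b) (tail-≢ a≢c) (tail-≢ b≢c))

-- Masks from ternary digits

digit : ℕ → ℕ → ℕ
digit zero x = x % 3
digit (suc i) x = digit i (x / 3)

digit<3 : ∀ i x → digit i x < 3
digit<3 zero x = m%n<n x 3
digit<3 (suc i) x = digit<3 i (x / 3)

digitMask : ℕ → ℕ → ℕ → Bool
digitMask i d x = ⌊ digit i x ≟ d ⌋

digitMasks : ℕ → List (ℕ → Bool)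
digitMasks zero = []
digitMasks (suc t) = digitMask t 0 ∷ digitMask t 1 ∷ digitMask t 2 ∷ digitMasks t

separatingMasks : ℕ → List (ℕ → Bool)
separatingMasks t = (λ _ → false) ∷ (λ _ → true) ∷ digitMasks t

length-separatingMasks : ∀ t → length (separatingMasks t) ≡ 2 + 3 * t
length-separatingMasks t = cong (2 +_) (lengthDigitMasks t)
  where
  lengthDigitMasks : ∀ t → length (digitMasks t) ≡ 3 * t
  lengthDigitMasks zero = refl
  lengthDigitMasks (suc t) = trans (cong (3 +_) (lengthDigitMasks t)) (sym (*-suc 3 t))

digitMask∈digitMasks : ∀ {t i d} → i < t → d < 3 → digitMask i d ∈ digitMasks t
digitMask∈digitMasks {suc t} {i} {d} i<1+t d<3 with i ≟ t
... | no i≢t = there (there (there (digitMask∈digitMasks (≤∧≢⇒< (≤-pred i<1+t) i≢t) d<3)))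
digitMask∈digitMasks {d = 0} _ _ | yes refl = here refl
digitMask∈digitMasks {d = 1} _ _ | yes refl = there (here refl)
digitMask∈digitMasks {d = 2} _ _ | yes refl = there (there (here refl))
digitMask∈digitMasks {d = suc (suc (suc _))} _ (s≤s (s≤s (s≤s ()))) | yes refl

distinctDigit : ∀ t {x y} → x < 3 ^ t → y < 3 ^ t → x ≢ y →
                ∃ λ i → i < t × digit i x ≢ digit i y
distinctDigit zero {zero} {zero} _ _ x≢y = ⊥-elim (x≢y refl)
distinctDigit zero {suc _} (s≤s ()) _ _
distinctDigit zero {zero} {suc _} _ (s≤s ()) _
distinctDigit (suc t) {x} {y} x< y< x≢y with x % 3 ≟ y % 3
... | no last≢ = 0 , s≤s z≤n , last≢
... | yes last≡ with distinctDigit t (quotient< x<) (quotient< y<) quotients≢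
  where
  quotient< : ∀ {z} → z < 3 ^ suc t → z / 3 < 3 ^ t
  quotient< {z} z< = m<n*o⇒m/o<n {z} {3 ^ t} {3} (subst (z <_) (*-comm 3 (3 ^ t)) z<)
  quotients≢ : x / 3 ≢ y / 3
  quotients≢ q≡ = x≢y (begin
    x                 ≡⟨ m≡m%n+[m/n]*n x 3 ⟩
    x % 3 + x / 3 * 3 ≡⟨ cong₂ (λ r q → r + q * 3) last≡ q≡ ⟩
    y % 3 + y / 3 * 3 ≡⟨ m≡m%n+[m/n]*n y 3 ⟨
    y                 ∎)
    where open ≡-Reasoning
... | i , i<t , digit≢ = suc i , s≤s i<t , digit≢

separatingMasks-realise : ∀ t {x y} → x < 3 ^ t → y < 3 ^ t → x ≢ y → ∀ α β →
           Σ (ℕ → Bool) λ M → M ∈ separatingMasks t × M x ≡ α × M y ≡ β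
separatingMasks-realise t _ _ _ false false = (λ _ → false) , here refl , refl , refl
separatingMasks-realise t _ _ _ true true = (λ _ → true) , there (here refl) , refl , refl
separatingMasks-realise t {x} {y} x< y< x≢y true false with distinctDigit t x< y< x≢y
... | i , i<t , digit≢ =
  digitMask i (digit i x) , there (there (digitMask∈digitMasks i<t (digit<3 i x))) ,
  ⌊⌋-true (digit i x ≟ digit i x) refl , ⌊⌋-false (digit i y ≟ digit i x) (digit≢ ∘ sym)
separatingMasks-realise t {x} {y} x< y< x≢y false true with distinctDigit t x< y< x≢y
... | i , i<t , digit≢ =
  digitMask i (digit i y) , there (there (digitMask∈digitMasks i<t (digit<3 i y))) ,
  ⌊⌋-false (digit i x ≟ digit i y) digit≢ , ⌊⌋-true (digit i y ≟ digit i y) refl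

-- The upper bound

module Construction (n t : ℕ) (n≤2^3^t : n ≤ 2 ^ (3 ^ t)) where

  private
    k : ℕ
    k = 3 ^ t

  word : Fin n → Vec Bool k
  word x = toBits k (toℕ x)

  word-injective : ∀ {x y} → word x ≡ word y → x ≡ y
  word-injective {x} {y} eq = Fin.toℕ-injective (begin
    toℕ x               ≡⟨ value-toBits k (<-≤-trans (Fin.toℕ<n x) n≤2^3^t) ⟨
    value (word x)      ≡⟨ cong value eq ⟩
    value (word y)      ≡⟨ value-toBits k (<-≤-trans (Fin.toℕ<n y) n≤2^3^t) ⟩
    toℕ y               ∎)
    where open ≡-Reasoning

  restrict : (ℕ → Bool) → Mask k
  restrict M j = M (toℕ j)

  key : (ℕ → Bool) → Fin n → ℕ
  key M x = maskedValue (restrict M) (word x)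

  key-injective : ∀ M → Injective _≡_ _≡_ (key M)
  key-injective M eq = word-injective (⊕-cancelʳ (restrict M) (value-injective eq))

  permutationFor : (ℕ → Bool) → Vec (Fin n) n
  permutationFor M = RankPermutation.rankPerm (key M) (key-injective M)

  private
    _≟ₚ_ : DecidableEquality (Vec (Fin n) n)
    _≟ₚ_ = ≡-dec Fin._≟_
    candidates : List (Vec (Fin n) n)
    candidates = map permutationFor (separatingMasks t)

  family : List (Vec (Fin n) n)
  family = deduplicate _≟ₚ_ candidates

  family-isFamily : IsFamily family
  family-isFamily = All.tabulate isPerm , Unique.deduplicate-! _≟ₚ_ candidates
    where
    isPerm : ∀ {σ} → σ ∈ family → IsPerm σ
    isPerm σ∈ with ∈-map⁻ permutationFor (∈-deduplicate⁻ _≟ₚ_ candidates σ∈)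
    ... | M , _ , refl = RankPermutation.rankPerm-isPerm (key M) (key-injective M)

  length-family : length family ≤ 2 + 3 * t
  length-family = begin
    length family       ≤⟨ length-deduplicate _≟ₚ_ candidates ⟩
    length candidates   ≡⟨ length-map permutationFor (separatingMasks t) ⟩
    length (separatingMasks t) ≡⟨ length-separatingMasks t ⟩
    2 + 3 * t           ∎
    where open ≤-Reasoning

  permutationFor∈family : ∀ {M} → M ∈ separatingMasks t → permutationFor M ∈ family
  permutationFor∈family M∈ = ∈-deduplicate⁺ _≟ₚ_ (∈-map⁺ permutationFor M∈)

  pattern3-permutationFor : ∀ M a b c →
    pattern3 (permutationFor M) a b c ≡ maskedPattern (restrict M) (word a) (word b) (word c)
  pattern3-permutationFor M = RankPermutation.pattern3-rankPerm (key M) (key-injective M)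

  private
    word≢ : ∀ {x y} → x <ᶠ y → word x ≢ word y
    word≢ x<y eq = <-irrefl (cong toℕ (word-injective eq)) x<y

    boolPairs : List (Bool × Bool)
    boolPairs = (false , false) ∷ (false , true) ∷ (true , false) ∷ (true , true) ∷ []

    boolPairs! : Unique boolPairs
    boolPairs! =
      ((λ ()) ∷ (λ ()) ∷ (λ ()) ∷ []) ∷ ((λ ()) ∷ (λ ()) ∷ []) ∷ ((λ ()) ∷ []) ∷ [] ∷ []

  family-shatters : PartiallyShatters family 4
  family-shatters a b c a<b b<c
    with twoDeterminedBits (word a) (word b) (word c) (word≢ a<b) (word≢ (<-trans a<b b<c)) (word≢ b<c)
  ... | i , j , i≢j , detᵢ , detⱼ = map patternOf boolPairs , patterns! , ≤-refl , patternsRealised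
    where
    separating : ∀ q → Σ (ℕ → Bool) λ M →
                 M ∈ separatingMasks t × M (toℕ i) ≡ proj₁ q × M (toℕ j) ≡ proj₂ q
    separating (α , β) =
      separatingMasks-realise t (Fin.toℕ<n i) (Fin.toℕ<n j) (i≢j ∘ Fin.toℕ-injective) α β

    patternOf : Bool × Bool → Pattern
    patternOf q = pattern3 (permutationFor (proj₁ (separating q))) a b c

    patternOf-injective : ∀ {q q'} → patternOf q ≡ patternOf q' → q ≡ q'
    patternOf-injective {q} {q'} eq with separating q | separating q'
    ... | M , _ , Mi , Mj | M' , _ , M'i , M'j = ×-≡,≡→≡ (bit detᵢ Mi M'i , bit detⱼ Mj M'j)
      where
      masked≡ : maskedPattern (restrict M) (word a) (word b) (word c) ≡
                maskedPattern (restrict M') (word a) (word b) (word c)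
      masked≡ = trans (sym (pattern3-permutationFor M a b c)) (trans eq (pattern3-permutationFor M' a b c))
      bit : ∀ {l x x'} → Determines (λ m → maskedPattern m (word a) (word b) (word c)) l →
            M (toℕ l) ≡ x → M' (toℕ l) ≡ x' → x ≡ x'
      bit det refl refl = det (restrict M) (restrict M') masked≡

    patterns! : Unique (map patternOf boolPairs)
    patterns! = map⁺ patternOf-injective boolPairs!

    realise : ∀ q → Σ (Vec (Fin n) n) λ σ → σ ∈ family × pattern3 σ a b c ≡ patternOf q
    realise q =
      permutationFor (proj₁ (separating q)) , permutationFor∈family (proj₁ (proj₂ (separating q))) , refl

    patternsRealised :
      All (λ p → Σ (Vec (Fin n) n) λ σ → σ ∈ family × pattern3 σ a b c ≡ p) (map patternOf boolPairs)
    -- Naming f and xs keeps Agda from unfolding patternOf while inferring them.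
    patternsRealised = All.map⁺ {f = patternOf} (All.tabulate {xs = boolPairs} (λ {q} _ → realise q))

n<2^n : ∀ n → n < 2 ^ n
n<2^n zero = s≤s z≤n
n<2^n (suc n) = begin-strict
  suc n         <⟨ s≤s (n<2^n n) ⟩
  suc (2 ^ n)   ≤⟨ +-monoˡ-≤ (2 ^ n) (m^n>0 2 n) ⟩
  2 ^ n + 2 ^ n ≡⟨ cong (2 ^ n +_) (+-identityʳ (2 ^ n)) ⟨
  2 ^ suc n     ∎
  where open ≤-Reasoning

crossing : ∀ (f : ℕ → ℕ) d {t₀ n} → f t₀ < n → n ≤ f (d + t₀) →
           ∃ λ t → t₀ ≤ t × f t < n × n ≤ f (suc t)
crossing f zero f₀<n n≤f₀ = ⊥-elim (<⇒≱ f₀<n n≤f₀)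
crossing f (suc d) {t₀} {n} f₀<n n≤f with n ≤? f (suc t₀)
... | yes n≤f₁ = t₀ , ≤-refl , f₀<n , n≤f₁
... | no n≰f₁ with crossing f d (≰⇒> n≰f₁) (subst (λ s → n ≤ f s) (sym (+-suc d t₀)) n≤f)
...   | t , 1+t₀≤t , below , above = t , ≤-trans (n≤1+n t₀) 1+t₀≤t , below , above

-- 9 ^ t overtakes 2 ^ (3t + 5) once t log₂(9/8) ≥ 5, i.e. from t = 30 on.
2^[3t+5]≤[3^t]² : ∀ {t} → 30 ≤ t → 2 ^ (3 * t + 5) ≤ 3 ^ t * 3 ^ t
2^[3t+5]≤[3^t]² {t} 30≤t =
  subst (λ s → 2 ^ (3 * s + 5) ≤ 3 ^ s * 3 ^ s) (m∸n+n≡m 30≤t) (from30 (t ∸ 30))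
  where
  from30 : ∀ d → 2 ^ (3 * (d + 30) + 5) ≤ 3 ^ (d + 30) * 3 ^ (d + 30)
  from30 zero = ≤ᵇ⇒≤ (2 ^ 95) (3 ^ 30 * 3 ^ 30) _
  from30 (suc d) = begin
    2 ^ (3 * (suc d + 30) + 5)        ≡⟨ cong (2 ^_) (exponent (d + 30)) ⟩
    2 ^ (3 + (3 * (d + 30) + 5))      ≡⟨ ^-distribˡ-+-* 2 3 (3 * (d + 30) + 5) ⟩
    8 * 2 ^ (3 * (d + 30) + 5)        ≤⟨ *-mono-≤ (n≤1+n 8) (from30 d) ⟩
    9 * (3 ^ (d + 30) * 3 ^ (d + 30)) ≡⟨ nine (3 ^ (d + 30)) ⟩
    3 ^ suc (d + 30) * 3 ^ suc (d + 30) ∎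
    where
    open ≤-Reasoning
    exponent : ∀ s → 3 * suc s + 5 ≡ 3 + (3 * s + 5)
    exponent = solve-∀
    nine : ∀ x → 9 * (x * x) ≡ (3 * x) * (3 * x)
    nine = solve-∀

upperBound-of-square : ∀ {n m} L → 2 ^ m ≤ L * L → 2 ^ L ≤ n → UpperBound n m
upperBound-of-square {n} {m} L 2^m≤L² 2^L≤n p q _ p²<2^mq² = begin
  2 ^ p         ≤⟨ ^-monoʳ-≤ 2 (<⇒≤ p<Lq) ⟩
  2 ^ (L * q)   ≡⟨ ^-*-assoc 2 L q ⟨
  (2 ^ L) ^ q   ≤⟨ ^-monoˡ-≤ q 2^L≤n ⟩
  n ^ q         ∎
  where
  open ≤-Reasoning
  p²<[Lq]² : p * p < (L * q) * (L * q)
  p²<[Lq]² = begin-strict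
    p * p               <⟨ p²<2^mq² ⟩
    2 ^ m * (q * q)     ≤⟨ *-monoˡ-≤ (q * q) 2^m≤L² ⟩
    (L * L) * (q * q)   ≡⟨ swap-middle L q ⟩
    (L * q) * (L * q)   ∎
    where
    swap-middle : ∀ a b → (a * a) * (b * b) ≡ (a * b) * (a * b)
    swap-middle = solve-∀
  p<Lq : p < L * q
  p<Lq with p <? L * q
  ... | yes p<Lq = p<Lq
  ... | no p≮Lq = ⊥-elim (<⇒≱ p²<[Lq]² (*-mono-≤ (≮⇒≥ p≮Lq) (≮⇒≥ p≮Lq)))

upperBound : ∀ {n m t} → 30 ≤ t → 2 ^ (3 ^ t) < n → n ≤ 2 ^ (3 ^ suc t) →
             IsF3 n 4 m → UpperBound n m
upperBound {n} {m} {t} 30≤t below above (_ , minimal) =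
  upperBound-of-square {n} {m} (3 ^ t) 2^m≤[3^t]² (<⇒≤ below)
  where
  open Construction n (suc t) above
  2+3[1+t] : ∀ s → 2 + 3 * suc s ≡ 3 * s + 5
  2+3[1+t] = solve-∀
  m≤3t+5 : m ≤ 3 * t + 5
  m≤3t+5 = ≤-trans (minimal family family-isFamily family-shatters)
                   (≤-trans length-family (≤-reflexive (2+3[1+t] t)))
  2^m≤[3^t]² : 2 ^ m ≤ 3 ^ t * 3 ^ t
  2^m≤[3^t]² = ≤-trans (^-monoʳ-≤ 2 m≤3t+5) (2^[3t+5]≤[3^t]² 30≤t)

-- Stated for a variable t₀: unifying with the literal 2 ^ (3 ^ 30) makes Agda
-- try to evaluate it.
bothBounds : ∀ {n m t₀} → 30 ≤ t₀ → 2 ^ (3 ^ t₀) < n → IsF3 n 4 m →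
             LowerBound n m × UpperBound n m
bothBounds {n} {m} {t₀} 30≤t₀ big isF3 with crossing (λ t → 2 ^ (3 ^ t)) n big n≤2^3^[n+t₀]
  where
  n≤2^3^[n+t₀] : n ≤ 2 ^ (3 ^ (n + t₀))
  n≤2^3^[n+t₀] = begin
    n                  ≤⟨ m≤m+n n t₀ ⟩
    n + t₀             ≤⟨ <⇒≤ (n<2^n (n + t₀)) ⟩
    2 ^ (n + t₀)       ≤⟨ ^-monoˡ-≤ (n + t₀) (n≤1+n 2) ⟩
    3 ^ (n + t₀)       ≤⟨ <⇒≤ (n<2^n (3 ^ (n + t₀))) ⟩
    2 ^ (3 ^ (n + t₀)) ∎
    where open ≤-Reasoning
... | t , t₀≤t , below , above =
  lowerBound 3≤n isF3 , upperBound (≤-trans 30≤t₀ t₀≤t) below above isF3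
  where
  3≤n : 3 ≤ n
  3≤n = ≤-trans (s≤s (^-monoʳ-≤ 2 (m^n>0 3 t₀))) big

theorem2p7 : Σ ℕ λ N → ∀ (n : ℕ) → N ≤ n → ∀ (m : ℕ) → IsF3 n 4 m →
                 LowerBound n m × UpperBound n m
theorem2p7 = suc (2 ^ (3 ^ 30)) , λ n big m → bothBounds {t₀ = 30} ≤-refl big
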